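{- Let $\mathcal{E}$ be a model of CETCS. Then the full subcategory of choice objects of $\mathcal{E}$ has finite products and weak equalisers, and $\mathcal{E}$ is (equivalent to) the exact completion of this subcategory.
   Context: Global elements $x\colon1\to X$ are written $x\in X$; for $a\colon A\to X$, $x\in_a$ means some $u\in A$ has $au=x$; $a$ is surjective if $x\in_a$ for all $x$; an object is a choice object if every surjection onto it has a section. A weak limit is a limit without uniqueness of mediating arrows. CETCS: a category $\mathcal{E}$ is a model of CETCS if: (C1) it has finite limits and finite colimits; (C2) every composable pair $Y\xrightarrow{g}X\xrightarrow{f}I$ has a universal dependent product, i.e. $\phi\colon F\to I$ and a mono $\alpha\colon P\rightarrowtail F\times X\times Y$ such that for all elements: $\langle j,x,y\rangle\in_\alpha\Rightarrow gy=x$; $fx=\phi j\iff\exists y\,\langle j,x,y\rangle\in_\alpha$; $\langle j,x,y\rangle\in_\alpha\wedge\langle j,x',y'\rangle\in_\alpha\wedge x=x'\Rightarrow y=y'$; and for every mono $r\colon R\rightarrowtail X\times Y$ and $i\in I$ such that $\langle x,y\rangle\in_r\Rightarrow gy=x$, $fx=i\iff\exists y\,\langle x,y\rangle\in_r$, and $\langle x,y\rangle,\langle x,y'\rangle\in_r\Rightarrow y=y'$, there is a unique $c\in F$ with $\phi c=i$ and $\langle c,x,y\rangle\in_\alpha\iff\langle x,y\rangle\in_r$ for all $x,y$; (C3) there is a natural numbers object; (C4) the terminal object is a strong generator (every $f\colon X\to Y$ such that each $y\in Y$ equals $fx$ for a unique $x\in X$ is iso) and separating ($fx=gx$ for all $x\in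 X$ implies $f=g$); (C5) every object is the codomain of a surjection from a choice object; (C6) the initial object has no global elements; (C7) in every coproduct diagram $i\colon X\to S\leftarrow Y\colon j$, every $z\in S$ satisfies $z\in_i$ or $z\in_j$; (C8) in every coproduct diagram $i\colon1\to S\leftarrow1\colon j$, $i\neq j$; (C9) every arrow factors as a surjection followed by a mono; (C10) every equivalence relation is a kernel pair. Exact completion of a category $\mathcal{P}$ with finite products and weak equalisers: objects are pseudo-equivalence relations $r=\langle r_1,r_2\rangle\colon R\to X\times X$ (arrows for which there exist, not necessarily unique, $\rho$ with $r\rho=\langle1,1\rangle$, $\sigma$ with $r\sigma=\langle r_2,r_1\rangle$, and $\tau\colon Q\to R$ with $r\tau=\langle r_1p_1,r_2p_2\rangle$ for $(Q,p_1,p_2)$ a weak pullback of $r_2,r_1$); arrows $r\to s$ (with $s\colon S\to Y\times Y$) are classes $[f]$ of $f\colon X\to Y$ admitting $\hat f\colon R\to S$ with $s\hat f=(f\times f)r$, where $f\sim g$ iff some $h\colon X\to S$ has $sh=\langle f,g\rangle$. -}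

module Defs where

open import Level using (Level; _⊔_; suc)
open import Data.Product using (Σ; Σ-syntax; _×_; _,_; proj₁; proj₂)
open import Data.Sum using (_⊎_)
open import Data.Empty using (⊥)
open import Relation.Nullary using (¬_)
open import Relation.Binary using (Rel; IsEquivalence; Setoid)
import Relation.Binary.Reasoning.Setoid as SetoidR

record Category (o ℓ e : Level) : Set (suc (o ⊔ ℓ ⊔ e)) where
  infixr 9 _∘_
  infix 4 _≈_ _⇒_
  field
    Obj : Set o
    _⇒_ : Obj → Obj → Set ℓ
    _≈_ : ∀ {A B} → Rel (A ⇒ B) e
    id : ∀ {A} → A ⇒ A
    _∘_ : ∀ {A B C} → B ⇒ C → A ⇒ B → A ⇒ C
    equiv : ∀ {A B} → IsEquivalence (_≈_ {A} {B})
    assoc : ∀ {A B C D} {f : A ⇒ B} {g : B ⇒ C} {h : C ⇒ D} →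
            (h ∘ g) ∘ f ≈ h ∘ (g ∘ f)
    identityˡ : ∀ {A B} {f : A ⇒ B} → id ∘ f ≈ f
    identityʳ : ∀ {A B} {f : A ⇒ B} → f ∘ id ≈ f
    ∘-resp-≈ : ∀ {A B C} {f h : B ⇒ C} {g i : A ⇒ B} →
               f ≈ h → g ≈ i → f ∘ g ≈ h ∘ i

  hom-setoid : Obj → Obj → Setoid ℓ e
  hom-setoid A B = record { Carrier = A ⇒ B ; _≈_ = _≈_ ; isEquivalence = equiv }

  module Eq {A B : Obj} = IsEquivalence (equiv {A} {B})

module Notions {o ℓ e} (C : Category o ℓ e) where
  open Category C

  Unique : ∀ {p} {A B : Obj} → (A ⇒ B → Set p) → Set (ℓ ⊔ e ⊔ p)
  Unique {A = A} {B} P = Σ[ u ∈ A ⇒ B ] (P u × (∀ (u' : A ⇒ B) → P u' → u' ≈ u))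

  Mono : ∀ {A B} → A ⇒ B → Set (o ⊔ ℓ ⊔ e)
  Mono {A} m = ∀ {T} (g h : T ⇒ A) → m ∘ g ≈ m ∘ h → g ≈ h

  JointlyMonic₂ : ∀ {R X Y} → R ⇒ X → R ⇒ Y → Set (o ⊔ ℓ ⊔ e)
  JointlyMonic₂ {R} a b = ∀ {T} (g h : T ⇒ R) → a ∘ g ≈ a ∘ h → b ∘ g ≈ b ∘ h → g ≈ h

  JointlyMonic₃ : ∀ {R X Y Z} → R ⇒ X → R ⇒ Y → R ⇒ Z → Set (o ⊔ ℓ ⊔ e)
  JointlyMonic₃ {R} a b c = ∀ {T} (g h : T ⇒ R) →
    a ∘ g ≈ a ∘ h → b ∘ g ≈ b ∘ h → c ∘ g ≈ c ∘ h → g ≈ h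

  IsIso : ∀ {A B} → A ⇒ B → Set (ℓ ⊔ e)
  IsIso {A} {B} f = Σ[ g ∈ B ⇒ A ] (g ∘ f ≈ id × f ∘ g ≈ id)

  record Terminal : Set (o ⊔ ℓ ⊔ e) where
    field
      ⊤ : Obj
      ! : ∀ {A} → A ⇒ ⊤
      !-unique : ∀ {A} (f : A ⇒ ⊤) → f ≈ !

  record Initial : Set (o ⊔ ℓ ⊔ e) where
    field
      ⊥₀ : Obj
      ¡ : ∀ {A} → ⊥₀ ⇒ A
      ¡-unique : ∀ {A} (f : ⊥₀ ⇒ A) → f ≈ ¡

  record Product (A B : Obj) : Set (o ⊔ ℓ ⊔ e) where
    field
      A×B : Obj
      π₁ : A×B ⇒ A
      π₂ : A×B ⇒ B
      ⟨_,_⟩ : ∀ {T} → T ⇒ A → T ⇒ B → T ⇒ A×B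
      project₁ : ∀ {T} {f : T ⇒ A} {g : T ⇒ B} → π₁ ∘ ⟨ f , g ⟩ ≈ f
      project₂ : ∀ {T} {f : T ⇒ A} {g : T ⇒ B} → π₂ ∘ ⟨ f , g ⟩ ≈ g
      unique : ∀ {T} {f : T ⇒ A} {g : T ⇒ B} (h : T ⇒ A×B) →
               π₁ ∘ h ≈ f → π₂ ∘ h ≈ g → h ≈ ⟨ f , g ⟩

  record Coproduct (A B : Obj) : Set (o ⊔ ℓ ⊔ e) where
    field
      A+B : Obj
      i₁ : A ⇒ A+B
      i₂ : B ⇒ A+B
      [_,_] : ∀ {T} → A ⇒ T → B ⇒ T → A+B ⇒ T
      inject₁ : ∀ {T} {f : A ⇒ T} {g : B ⇒ T} → [ f , g ] ∘ i₁ ≈ f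
      inject₂ : ∀ {T} {f : A ⇒ T} {g : B ⇒ T} → [ f , g ] ∘ i₂ ≈ g
      unique : ∀ {T} {f : A ⇒ T} {g : B ⇒ T} (h : A+B ⇒ T) →
               h ∘ i₁ ≈ f → h ∘ i₂ ≈ g → h ≈ [ f , g ]

  record Equaliser {A B : Obj} (f g : A ⇒ B) : Set (o ⊔ ℓ ⊔ e) where
    field
      E : Obj
      arr : E ⇒ A
      equality : f ∘ arr ≈ g ∘ arr
      universal : ∀ {T} (h : T ⇒ A) → f ∘ h ≈ g ∘ h →
                  Unique (λ (u : T ⇒ E) → arr ∘ u ≈ h)

  record WeakEqualiser {A B : Obj} (f g : A ⇒ B) : Set (o ⊔ ℓ ⊔ e) where
    field
      E : Obj
      arr : E ⇒ A
      equality : f ∘ arr ≈ g ∘ arr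
      universal : ∀ {T} (h : T ⇒ A) → f ∘ h ≈ g ∘ h →
                  Σ[ u ∈ T ⇒ E ] (arr ∘ u ≈ h)

  record Coequaliser {A B : Obj} (f g : A ⇒ B) : Set (o ⊔ ℓ ⊔ e) where
    field
      Q : Obj
      arr : B ⇒ Q
      equality : arr ∘ f ≈ arr ∘ g
      universal : ∀ {T} (h : B ⇒ T) → h ∘ f ≈ h ∘ g →
                  Unique (λ (u : Q ⇒ T) → u ∘ arr ≈ h)

  IsPullback : ∀ {A B Z Q} (f : A ⇒ Z) (g : B ⇒ Z) (p₁ : Q ⇒ A) (p₂ : Q ⇒ B) →
               Set (o ⊔ ℓ ⊔ e)
  IsPullback {A} {B} {Z} {Q} f g p₁ p₂ =
    f ∘ p₁ ≈ g ∘ p₂ ×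
    (∀ {T} (a : T ⇒ A) (b : T ⇒ B) → f ∘ a ≈ g ∘ b →
       Unique (λ (u : T ⇒ Q) → p₁ ∘ u ≈ a × p₂ ∘ u ≈ b))

  IsWeakPullback : ∀ {A B Z Q} (f : A ⇒ Z) (g : B ⇒ Z) (p₁ : Q ⇒ A) (p₂ : Q ⇒ B) →
                   Set (o ⊔ ℓ ⊔ e)
  IsWeakPullback {A} {B} {Z} {Q} f g p₁ p₂ =
    f ∘ p₁ ≈ g ∘ p₂ ×
    (∀ {T} (a : T ⇒ A) (b : T ⇒ B) → f ∘ a ≈ g ∘ b →
       Σ[ u ∈ T ⇒ Q ] (p₁ ∘ u ≈ a × p₂ ∘ u ≈ b))

  IsCoproduct : ∀ {X Y S} → X ⇒ S → Y ⇒ S → Set (o ⊔ ℓ ⊔ e)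
  IsCoproduct {X} {Y} {S} i j =
    ∀ {T} (f : X ⇒ T) (g : Y ⇒ T) → Unique (λ (h : S ⇒ T) → h ∘ i ≈ f × h ∘ j ≈ g)

  IsEquivalenceRelation : ∀ {R X} → R ⇒ X → R ⇒ X → Set (o ⊔ ℓ ⊔ e)
  IsEquivalenceRelation {R} {X} r₁ r₂ =
    JointlyMonic₂ r₁ r₂ ×
    (Σ[ ρ ∈ X ⇒ R ] (r₁ ∘ ρ ≈ id × r₂ ∘ ρ ≈ id)) ×
    (Σ[ σ ∈ R ⇒ R ] (r₁ ∘ σ ≈ r₂ × r₂ ∘ σ ≈ r₁)) ×
    (∀ {Q} (p₁ p₂ : Q ⇒ R) → IsPullback r₂ r₁ p₁ p₂ →
       Σ[ τ ∈ Q ⇒ R ] (r₁ ∘ τ ≈ r₁ ∘ p₁ × r₂ ∘ τ ≈ r₂ ∘ p₂))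

  IsKernelPair : ∀ {R X} → R ⇒ X → R ⇒ X → Set (o ⊔ ℓ ⊔ e)
  IsKernelPair {R} {X} r₁ r₂ = Σ[ Y ∈ Obj ] Σ[ f ∈ X ⇒ Y ] IsPullback f f r₁ r₂

  HasFiniteProducts : Set (o ⊔ ℓ ⊔ e)
  HasFiniteProducts = Terminal × (∀ A B → Product A B)

  HasWeakEqualisers : Set (o ⊔ ℓ ⊔ e)
  HasWeakEqualisers = ∀ {A B} (f g : A ⇒ B) → WeakEqualiser f g

  record FiniteLimits : Set (o ⊔ ℓ ⊔ e) where
    field
      terminal : Terminal
      products : ∀ A B → Product A B
      equalisers : ∀ {A B} (f g : A ⇒ B) → Equaliser f g

  record FiniteColimits : Set (o ⊔ ℓ ⊔ e) where
    field
      initial : Initial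
      coproducts : ∀ A B → Coproduct A B
      coequalisers : ∀ {A B} (f g : A ⇒ B) → Coequaliser f g

  module Elements (T : Terminal) where
    open Terminal T renaming (⊤ to 𝟏)

    Elt : Obj → Set ℓ
    Elt X = 𝟏 ⇒ X

    _∈[_] : ∀ {A X} → Elt X → A ⇒ X → Set (ℓ ⊔ e)
    _∈[_] {A} x a = Σ[ u ∈ Elt A ] (a ∘ u ≈ x)

    ⟨_,_⟩∈[_,_] : ∀ {R X Y} → Elt X → Elt Y → R ⇒ X → R ⇒ Y → Set (ℓ ⊔ e)
    ⟨_,_⟩∈[_,_] {R} x y r₁ r₂ = Σ[ u ∈ Elt R ] (r₁ ∘ u ≈ x × r₂ ∘ u ≈ y)

    ⟨_︔_︔_⟩∈[_︔_︔_] : ∀ {P F X Y} → Elt F → Elt X → Elt Y →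
                      P ⇒ F → P ⇒ X → P ⇒ Y → Set (ℓ ⊔ e)
    ⟨_︔_︔_⟩∈[_︔_︔_] {P} j x y a₁ a₂ a₃ =
      Σ[ u ∈ Elt P ] (a₁ ∘ u ≈ j × a₂ ∘ u ≈ x × a₃ ∘ u ≈ y)

    Surjective : ∀ {A X} → A ⇒ X → Set (ℓ ⊔ e)
    Surjective {A} {X} a = ∀ (x : Elt X) → x ∈[ a ]

    IsChoiceObject : Obj → Set (o ⊔ ℓ ⊔ e)
    IsChoiceObject X = ∀ {A} (a : A ⇒ X) → Surjective a →
                       Σ[ s ∈ X ⇒ A ] (a ∘ s ≈ id)

    _⇔_ : ∀ {a b} → Set a → Set b → Set (a ⊔ b)
    P ⇔ Q = (P → Q) × (Q → P)

    record DependentProduct {Y X I : Obj} (g : Y ⇒ X) (f : X ⇒ I) : Set (o ⊔ ℓ ⊔ e) where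
      field
        F : Obj
        φ : F ⇒ I
        P : Obj
        α₁ : P ⇒ F
        α₂ : P ⇒ X
        α₃ : P ⇒ Y
        α-mono : JointlyMonic₃ α₁ α₂ α₃
        ax-graph : ∀ j x y → ⟨ j ︔ x ︔ y ⟩∈[ α₁ ︔ α₂ ︔ α₃ ] → g ∘ y ≈ x
        ax-total : ∀ j x → (f ∘ x ≈ φ ∘ j) ⇔ (Σ[ y ∈ Elt Y ] ⟨ j ︔ x ︔ y ⟩∈[ α₁ ︔ α₂ ︔ α₃ ])
        ax-functional : ∀ j x y x' y' → ⟨ j ︔ x ︔ y ⟩∈[ α₁ ︔ α₂ ︔ α₃ ] →
                        ⟨ j ︔ x' ︔ y' ⟩∈[ α₁ ︔ α₂ ︔ α₃ ] → x ≈ x' → y ≈ y'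
        universal : ∀ {R} (r₁ : R ⇒ X) (r₂ : R ⇒ Y) → JointlyMonic₂ r₁ r₂ →
          (i : Elt I) →
          (∀ x y → ⟨ x , y ⟩∈[ r₁ , r₂ ] → g ∘ y ≈ x) →
          (∀ x → (f ∘ x ≈ i) ⇔ (Σ[ y ∈ Elt Y ] ⟨ x , y ⟩∈[ r₁ , r₂ ])) →
          (∀ x y y' → ⟨ x , y ⟩∈[ r₁ , r₂ ] → ⟨ x , y' ⟩∈[ r₁ , r₂ ] → y ≈ y') →
          Unique (λ (c : Elt F) → φ ∘ c ≈ i ×
            (∀ x y → ⟨ c ︔ x ︔ y ⟩∈[ α₁ ︔ α₂ ︔ α₃ ] ⇔ ⟨ x , y ⟩∈[ r₁ , r₂ ]))

    record NNO : Set (o ⊔ ℓ ⊔ e) where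
      field
        N : Obj
        z : Elt N
        s : N ⇒ N
        rec : ∀ {X} (x : Elt X) (h : X ⇒ X) →
              Unique (λ (u : N ⇒ X) → u ∘ z ≈ x × u ∘ s ≈ h ∘ u)

record CETCS {o ℓ e} (C : Category o ℓ e) : Set (suc (o ⊔ ℓ ⊔ e)) where
  open Category C
  open Notions C
  field
    C1-limits : FiniteLimits
    C1-colimits : FiniteColimits
  open FiniteLimits C1-limits using (terminal)
  open FiniteColimits C1-colimits using (initial)
  open Elements terminal public
  open Initial initial using (⊥₀)
  field
    C2 : ∀ {Y X I} (g : Y ⇒ X) (f : X ⇒ I) → DependentProduct g f
    C3 : NNO
    C4-generator : ∀ {X Y} (f : X ⇒ Y) →
      (∀ (y : Elt Y) → Σ[ x ∈ Elt X ] (f ∘ x ≈ y × (∀ x' → f ∘ x' ≈ y → x' ≈ x))) →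
      IsIso f
    C4-separating : ∀ {X Y} (f g : X ⇒ Y) → (∀ (x : Elt X) → f ∘ x ≈ g ∘ x) → f ≈ g
    C5 : ∀ X → Σ[ A ∈ Obj ] (IsChoiceObject A × Σ[ a ∈ A ⇒ X ] Surjective a)
    C6 : Elt ⊥₀ → ⊥
    C7 : ∀ {X Y S} (i : X ⇒ S) (j : Y ⇒ S) → IsCoproduct i j →
         ∀ (z : Elt S) → z ∈[ i ] ⊎ z ∈[ j ]
    C8 : ∀ {S} (i j : Elt S) → IsCoproduct i j → ¬ (i ≈ j)
    C9 : ∀ {X Y} (f : X ⇒ Y) →
         Σ[ M ∈ Obj ] Σ[ p ∈ X ⇒ M ] Σ[ m ∈ M ⇒ Y ]
           (Surjective p × Mono m × m ∘ p ≈ f)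
    C10 : ∀ {R X} (r₁ r₂ : R ⇒ X) → IsEquivalenceRelation r₁ r₂ → IsKernelPair r₁ r₂

FullSubcategory : ∀ {o ℓ e p} (C : Category o ℓ e) → (Category.Obj C → Set p) →
                  Category (o ⊔ p) ℓ e
FullSubcategory C P = record
  { Obj = Σ Obj P
  ; _⇒_ = λ A B → proj₁ A ⇒ proj₁ B
  ; _≈_ = _≈_
  ; id = id
  ; _∘_ = _∘_
  ; equiv = equiv
  ; assoc = assoc
  ; identityˡ = identityˡ
  ; identityʳ = identityʳ
  ; ∘-resp-≈ = ∘-resp-≈
  }
  where open Category C

ChoiceObjects : ∀ {o ℓ e} (C : Category o ℓ e) → CETCS C → Category (o ⊔ ℓ ⊔ e) ℓ e
ChoiceObjects C M = FullSubcategory C (CETCS.IsChoiceObject M)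

module ExactCompletion {o ℓ e} (P : Category o ℓ e) where
  open Category P
  open Notions P

  -- pseudo-equivalence relation r = ⟨r₁,r₂⟩ : R → X × X
  record PER : Set (o ⊔ ℓ ⊔ e) where
    field
      X : Obj
      R : Obj
      r₁ : R ⇒ X
      r₂ : R ⇒ X
      ρ : X ⇒ R
      ρ₁ : r₁ ∘ ρ ≈ id
      ρ₂ : r₂ ∘ ρ ≈ id
      σ : R ⇒ R
      σ₁ : r₁ ∘ σ ≈ r₂
      σ₂ : r₂ ∘ σ ≈ r₁
      Q : Obj
      q₁ : Q ⇒ R
      q₂ : Q ⇒ R
      Q-wpb : IsWeakPullback r₂ r₁ q₁ q₂
      τ : Q ⇒ R
      τ₁ : r₁ ∘ τ ≈ r₁ ∘ q₁
      τ₂ : r₂ ∘ τ ≈ r₂ ∘ q₂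

  -- representatives f : X → Y with some f̂ : R → S, s f̂ = (f × f) r
  record ExHom (r s : PER) : Set (ℓ ⊔ e) where
    private module r = PER r
    private module s = PER s
    field
      f : r.X ⇒ s.X
      f̂ : r.R ⇒ s.R
      f̂₁ : s.r₁ ∘ f̂ ≈ f ∘ r.r₁
      f̂₂ : s.r₂ ∘ f̂ ≈ f ∘ r.r₂

  _∼_ : ∀ {r s} → Rel (ExHom r s) (ℓ ⊔ e)
  _∼_ {r} {s} F G = Σ[ h ∈ PER.X r ⇒ PER.R s ]
    (PER.r₁ s ∘ h ≈ ExHom.f F × PER.r₂ s ∘ h ≈ ExHom.f G)

  private
    pre : ∀ {A B C D} {a : C ⇒ D} {b : B ⇒ C} {c : B ⇒ D} {k : A ⇒ B} →
          a ∘ b ≈ c → a ∘ (b ∘ k) ≈ c ∘ k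
    pre eq = Eq.trans (Eq.sym assoc) (∘-resp-≈ eq Eq.refl)

    ≈⇒∼ : ∀ {r s} {F G : ExHom r s} → ExHom.f F ≈ ExHom.f G → F ∼ G
    ≈⇒∼ {r} {s} {F} {G} eq = PER.ρ s ∘ ExHom.f F ,
      Eq.trans (pre (PER.ρ₁ s)) identityˡ ,
      Eq.trans (pre (PER.ρ₂ s)) (Eq.trans identityˡ eq)

    ∼-sym : ∀ {r s} {F G : ExHom r s} → F ∼ G → G ∼ F
    ∼-sym {r} {s} (h , h₁ , h₂) = PER.σ s ∘ h ,
      Eq.trans (pre (PER.σ₁ s)) h₂ , Eq.trans (pre (PER.σ₂ s)) h₁

    ∼-trans : ∀ {r s} {F G H : ExHom r s} → F ∼ G → G ∼ H → F ∼ H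
    ∼-trans {r} {s} (h , h₁ , h₂) (k , k₁ , k₂) =
      let (u , u₁ , u₂) = proj₂ (PER.Q-wpb s) h k (Eq.trans h₂ (Eq.sym k₁))
      in PER.τ s ∘ u ,
         Eq.trans (pre (PER.τ₁ s)) (Eq.trans assoc (Eq.trans (∘-resp-≈ Eq.refl u₁) h₁)) ,
         Eq.trans (pre (PER.τ₂ s)) (Eq.trans assoc (Eq.trans (∘-resp-≈ Eq.refl u₂) k₂))

    ∼-equiv : ∀ {r s} → IsEquivalence (_∼_ {r} {s})
    ∼-equiv = record
      { refl = λ {F} → ≈⇒∼ {F = F} {G = F} Eq.refl
      ; sym = λ {F} {G} → ∼-sym {F = F} {G = G}
      ; trans = λ {F} {G} {H} → ∼-trans {F = F} {G = G} {H = H} }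

    idE : ∀ {r} → ExHom r r
    idE = record { f = id ; f̂ = id
                 ; f̂₁ = Eq.trans identityʳ (Eq.sym identityˡ)
                 ; f̂₂ = Eq.trans identityʳ (Eq.sym identityˡ) }

    swap : ∀ {A B B' C D} {a : C ⇒ D} {b : B ⇒ C} {c : A ⇒ B} {c' : B' ⇒ C} {d : A ⇒ B'} →
           b ∘ c ≈ c' ∘ d → (a ∘ b) ∘ c ≈ (a ∘ c') ∘ d
    swap eq = Eq.trans assoc (Eq.trans (∘-resp-≈ Eq.refl eq) (Eq.sym assoc))

    _∘E_ : ∀ {r s t} → ExHom s t → ExHom r s → ExHom r t
    G ∘E F = record
      { f = ExHom.f G ∘ ExHom.f F
      ; f̂ = ExHom.f̂ G ∘ ExHom.f̂ F
      ; f̂₁ = Eq.trans (Eq.sym assoc) (Eq.trans (∘-resp-≈ (ExHom.f̂₁ G) Eq.refl)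
               (swap (ExHom.f̂₁ F)))
      ; f̂₂ = Eq.trans (Eq.sym assoc) (Eq.trans (∘-resp-≈ (ExHom.f̂₂ G) Eq.refl)
               (swap (ExHom.f̂₂ F)))
      }

    ∘E-resp : ∀ {r s t} {G G' : ExHom s t} {F F' : ExHom r s} →
              G ∼ G' → F ∼ F' → (G ∘E F) ∼ (G' ∘E F')
    ∘E-resp {G = G} {G'} {F} {F'} (k , k₁ , k₂) (h , h₁ , h₂) =
      ∼-trans {F = G ∘E F} {G = G ∘E F'} {H = G' ∘E F'}
        (ExHom.f̂ G ∘ h ,
          Eq.trans (pre (ExHom.f̂₁ G)) (Eq.trans assoc (∘-resp-≈ Eq.refl h₁)) ,
          Eq.trans (pre (ExHom.f̂₂ G)) (Eq.trans assoc (∘-resp-≈ Eq.refl h₂)))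
        (k ∘ ExHom.f F' , pre k₁ , pre k₂)

  Ex : Category (o ⊔ ℓ ⊔ e) (ℓ ⊔ e) (ℓ ⊔ e)
  Ex = record
    { Obj = PER
    ; _⇒_ = ExHom
    ; _≈_ = _∼_
    ; id = idE
    ; _∘_ = _∘E_
    ; equiv = ∼-equiv
    ; assoc = λ {_} {_} {_} {_} {F} {G} {H} →
        ≈⇒∼ {F = (H ∘E G) ∘E F} {G = H ∘E (G ∘E F)} assoc
    ; identityˡ = λ {_} {_} {F} → ≈⇒∼ {F = idE ∘E F} {G = F} identityˡ
    ; identityʳ = λ {_} {_} {F} → ≈⇒∼ {F = F ∘E idE} {G = F} identityʳ
    ; ∘-resp-≈ = λ {_} {_} {_} {G} {G'} {F} {F'} → ∘E-resp {G = G} {G'} {F} {F'}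
    }

record Functor {o ℓ e o' ℓ' e'} (C : Category o ℓ e) (D : Category o' ℓ' e') :
               Set (o ⊔ ℓ ⊔ e ⊔ o' ⊔ ℓ' ⊔ e') where
  private module C = Category C
  private module D = Category D
  field
    F₀ : C.Obj → D.Obj
    F₁ : ∀ {A B} → A C.⇒ B → F₀ A D.⇒ F₀ B
    identity : ∀ {A} → F₁ (C.id {A}) D.≈ D.id
    homomorphism : ∀ {A B Z} {f : A C.⇒ B} {g : B C.⇒ Z} →
                   F₁ (g C.∘ f) D.≈ F₁ g D.∘ F₁ f
    F-resp-≈ : ∀ {A B} {f g : A C.⇒ B} → f C.≈ g → F₁ f D.≈ F₁ g

record Equivalence {o ℓ e o' ℓ' e'} (C : Category o ℓ e) (D : Category o' ℓ' e') :
                   Set (o ⊔ ℓ ⊔ e ⊔ o' ⊔ ℓ' ⊔ e') where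
  private module C = Category C
  private module D = Category D
  field
    F : Functor C D
    G : Functor D C
  private module F = Functor F
  private module G = Functor G
  field
    η : ∀ X → G.F₀ (F.F₀ X) C.⇒ X
    η⁻¹ : ∀ X → X C.⇒ G.F₀ (F.F₀ X)
    η-iso₁ : ∀ X → η X C.∘ η⁻¹ X C.≈ C.id
    η-iso₂ : ∀ X → η⁻¹ X C.∘ η X C.≈ C.id
    η-natural : ∀ {X Y} (f : X C.⇒ Y) → η Y C.∘ G.F₁ (F.F₁ f) C.≈ f C.∘ η X
    ε : ∀ Y → F.F₀ (G.F₀ Y) D.⇒ Y
    ε⁻¹ : ∀ Y → Y D.⇒ F.F₀ (G.F₀ Y)
    ε-iso₁ : ∀ Y → ε Y D.∘ ε⁻¹ Y D.≈ D.id
    ε-iso₂ : ∀ Y → ε⁻¹ Y D.∘ ε Y D.≈ D.id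
    ε-natural : ∀ {X Y} (f : X D.⇒ Y) → ε Y D.∘ F.F₁ (G.F₁ f) D.≈ f D.∘ ε X

module Submission where

-- Everything rests on two consequences of the axioms: choice objects are projective
-- for surjections (choice-lift), and every object is covered by one (C5).
--  * Ch has finite products since 𝟏 is a choice object and, via dependent products
--    (C2), so is a product of two choice objects; covering an equaliser (pullback) of 𝓔
--    by a choice object gives a weak equaliser (pullback) in Ch.
--  * F : 𝓔 → Ex(Ch) presents E by a cover A ↠ E and a cover B ↠ A ×_E A of its kernel
--    pair; G : Ex(Ch) → 𝓔 takes the coequaliser of a pseudo-equivalence relation.
--  * G F ≅ Id: coequalisers are surjective (C9), so the comparison map is bijective on
--    elements, hence invertible (C4).  F G ≅ Id: pseudo-equivalence relations of
--    choice objects are effective, because their image is an equivalence relation and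
--    thus a kernel pair (C10).

open import Defs
open import Level using (Level; _⊔_)
open import Data.Product using (Σ; Σ-syntax; _×_; _,_; proj₁; proj₂)
import Relation.Binary.Reasoning.Setoid as SetoidReasoning

module CategoryFacts {o ℓ e} (C : Category o ℓ e) where
  open Category C
  open Notions C

  module HomReasoning {A B : Obj} = SetoidReasoning (hom-setoid A B)
  open HomReasoning public using (begin_; step-≈-⟩; step-≈-⟨; _∎)

  sym : ∀ {A B} {f g : A ⇒ B} → f ≈ g → g ≈ f
  sym = Eq.sym

  trans : ∀ {A B} {f g h : A ⇒ B} → f ≈ g → g ≈ h → f ≈ h
  trans = Eq.trans

  refl : ∀ {A B} {f : A ⇒ B} → f ≈ f
  refl = Eq.refl

  sym-assoc : ∀ {A B C D} {f : A ⇒ B} {g : B ⇒ C} {h : C ⇒ D} →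
              h ∘ (g ∘ f) ≈ (h ∘ g) ∘ f
  sym-assoc = sym assoc

  infixr 4 _⟩∘⟨_ refl⟩∘⟨_
  infixl 5 _⟩∘⟨refl

  _⟩∘⟨_ : ∀ {A B C} {f h : B ⇒ C} {g i : A ⇒ B} → f ≈ h → g ≈ i → f ∘ g ≈ h ∘ i
  _⟩∘⟨_ = ∘-resp-≈

  refl⟩∘⟨_ : ∀ {A B C} {f : B ⇒ C} {g i : A ⇒ B} → g ≈ i → f ∘ g ≈ f ∘ i
  refl⟩∘⟨ p = ∘-resp-≈ refl p

  _⟩∘⟨refl : ∀ {A B C} {f h : B ⇒ C} {g : A ⇒ B} → f ≈ h → f ∘ g ≈ h ∘ g
  p ⟩∘⟨refl = ∘-resp-≈ p refl

  pullˡ : ∀ {A B C D} {a : C ⇒ D} {b : B ⇒ C} {c : B ⇒ D} {k : A ⇒ B} →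
          a ∘ b ≈ c → a ∘ (b ∘ k) ≈ c ∘ k
  pullˡ eq = trans sym-assoc (eq ⟩∘⟨refl)

  pullʳ : ∀ {A B C D} {a : B ⇒ C} {b : A ⇒ B} {c : A ⇒ C} {k : C ⇒ D} →
          a ∘ b ≈ c → (k ∘ a) ∘ b ≈ k ∘ c
  pullʳ eq = trans assoc (refl⟩∘⟨ eq)

  extend : ∀ {A B C D E} {a : C ⇒ E} {b : B ⇒ C} {c : D ⇒ E} {d : B ⇒ D} {k : A ⇒ B} →
           a ∘ b ≈ c ∘ d → a ∘ (b ∘ k) ≈ c ∘ (d ∘ k)
  extend eq = trans sym-assoc (trans (eq ⟩∘⟨refl) assoc)

  retraction⇒mono : ∀ {A B} {j : A ⇒ B} {r : B ⇒ A} → r ∘ j ≈ id → Mono j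
  retraction⇒mono {j = j} {r} rj g h eq = begin
    g            ≈⟨ identityˡ ⟨
    id ∘ g       ≈⟨ rj ⟩∘⟨refl ⟨
    (r ∘ j) ∘ g  ≈⟨ pullʳ eq ⟩
    r ∘ (j ∘ h)  ≈⟨ pullˡ rj ⟩
    id ∘ h       ≈⟨ identityˡ ⟩
    h            ∎

  module ProductOps {A B : Obj} (P : Product A B) where
    open Product P public

    ext : ∀ {T} {f g : T ⇒ A×B} → π₁ ∘ f ≈ π₁ ∘ g → π₂ ∘ f ≈ π₂ ∘ g → f ≈ g
    ext {f = f} {g} p q = trans (unique f p q) (sym (unique g refl refl))

  equaliser-mono : ∀ {A B} {f g : A ⇒ B} (E : Equaliser f g) → Mono (Equaliser.arr E)
  equaliser-mono E x y arr-x≈arr-y =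
    let (_ , _ , unique) = universal (arr ∘ y) (extend equality)
    in trans (unique x arr-x≈arr-y) (sym (unique y refl))
    where open Equaliser E

  module CoequaliserOps {A B} {f g : A ⇒ B} (Cq : Coequaliser f g) where
    open Coequaliser Cq public

    epi : ∀ {T} {u v : Q ⇒ T} → u ∘ arr ≈ v ∘ arr → u ≈ v
    epi {u = u} {v} eq =
      let (_ , _ , unique) = universal (u ∘ arr) (trans (pullʳ equality) sym-assoc)
      in trans (unique u refl) (sym (unique v (sym eq)))

    ind : ∀ {T} (h : B ⇒ T) → h ∘ f ≈ h ∘ g → Q ⇒ T
    ind h eq = proj₁ (universal h eq)

    ind-β : ∀ {T} {h : B ⇒ T} (eq : h ∘ f ≈ h ∘ g) → ind h eq ∘ arr ≈ h
    ind-β {h = h} eq = proj₁ (proj₂ (universal h eq))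

  module PullbackOps {A B Z Q} {f : A ⇒ Z} {g : B ⇒ Z} {p₁ : Q ⇒ A} {p₂ : Q ⇒ B}
                     (isPullback : IsPullback f g p₁ p₂) where
    commute : f ∘ p₁ ≈ g ∘ p₂
    commute = proj₁ isPullback

    univ : ∀ {T} (a : T ⇒ A) (b : T ⇒ B) → f ∘ a ≈ g ∘ b → T ⇒ Q
    univ a b eq = proj₁ (proj₂ isPullback a b eq)

    univ₁ : ∀ {T} {a : T ⇒ A} {b : T ⇒ B} (eq : f ∘ a ≈ g ∘ b) → p₁ ∘ univ a b eq ≈ a
    univ₁ {a = a} {b} eq = proj₁ (proj₁ (proj₂ (proj₂ isPullback a b eq)))

    univ₂ : ∀ {T} {a : T ⇒ A} {b : T ⇒ B} (eq : f ∘ a ≈ g ∘ b) → p₂ ∘ univ a b eq ≈ b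
    univ₂ {a = a} {b} eq = proj₂ (proj₁ (proj₂ (proj₂ isPullback a b eq)))

    jointly-monic : JointlyMonic₂ p₁ p₂
    jointly-monic u v e₁ e₂ =
      let unique = proj₂ (proj₂ (proj₂ isPullback (p₁ ∘ v) (p₂ ∘ v) (extend commute)))
      in trans (unique u (e₁ , e₂)) (sym (unique v (refl , refl)))

  record Pullback {A B Z} (f : A ⇒ Z) (g : B ⇒ Z) : Set (o ⊔ ℓ ⊔ e) where
    field
      P : Obj
      p₁ : P ⇒ A
      p₂ : P ⇒ B
      isPullback : IsPullback f g p₁ p₂
    open PullbackOps isPullback public

  pullback : FiniteLimits → ∀ {A B Z} (f : A ⇒ Z) (g : B ⇒ Z) → Pullback f g
  pullback L {A} {B} f g = record
    { P = E ; p₁ = π₁ ∘ arr ; p₂ = π₂ ∘ arr ; isPullback = square , universal-square }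
    where
    open ProductOps (FiniteLimits.products L A B)
    open Equaliser (FiniteLimits.equalisers L (f ∘ π₁) (g ∘ π₂))

    square : f ∘ (π₁ ∘ arr) ≈ g ∘ (π₂ ∘ arr)
    square = trans sym-assoc (trans equality assoc)

    universal-square : ∀ {T} (a : T ⇒ A) (b : T ⇒ B) → f ∘ a ≈ g ∘ b →
      Unique (λ (u : T ⇒ E) → (π₁ ∘ arr) ∘ u ≈ a × (π₂ ∘ arr) ∘ u ≈ b)
    universal-square a b eq =
      let (u , arr-u , u-unique) = universal ⟨ a , b ⟩
            (trans (pullʳ project₁) (trans eq (sym (pullʳ project₂))))
      in u , (trans (pullʳ arr-u) project₁ , trans (pullʳ arr-u) project₂) ,
         λ u' (e₁ , e₂) → u-unique u' (unique (arr ∘ u') (trans sym-assoc e₁) (trans sym-assoc e₂))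

module InModel {o ℓ e} (𝓔 : Category o ℓ e) (M : CETCS 𝓔) where
  open Category 𝓔
  open Notions 𝓔
  open CategoryFacts 𝓔
  open CETCS M
  open FiniteLimits C1-limits using (products; equalisers)
  open FiniteColimits C1-colimits using (coequalisers)
  open Terminal (FiniteLimits.terminal C1-limits) renaming (⊤ to 𝟏)

  pb : ∀ {A B Z} (f : A ⇒ Z) (g : B ⇒ Z) → Pullback f g
  pb = pullback C1-limits

  record Image {X Y} (f : X ⇒ Y) : Set (o ⊔ ℓ ⊔ e) where
    field
      I : Obj
      p : X ⇒ I
      m : I ⇒ Y
      p-surjective : Surjective p
      m-mono : Mono m
      factorisation : m ∘ p ≈ f

  image : ∀ {X Y} (f : X ⇒ Y) → Image f
  image f =
    let (I , p , m , p-surjective , m-mono , factorisation) = C9 f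
    in record { I = I ; p = p ; m = m ; p-surjective = p-surjective
              ; m-mono = m-mono ; factorisation = factorisation }

  record ChoiceCover (X : Obj) : Set (o ⊔ ℓ ⊔ e) where
    field
      A : Obj
      A-choice : IsChoiceObject A
      cover : A ⇒ X
      cover-surjective : Surjective cover

  choice-cover : ∀ X → ChoiceCover X
  choice-cover X =
    let (A , A-choice , cover , cover-surjective) = C5 X
    in record { A = A ; A-choice = A-choice ; cover = cover ; cover-surjective = cover-surjective }

  !-elt : ∀ {X} (x : Elt X) → ! ∘ x ≈ id
  !-elt x = trans (!-unique (! ∘ x)) (sym (!-unique id))

  pullback-surjective : ∀ {T B K Q} {t : T ⇒ K} {b : B ⇒ K} {p₁ : Q ⇒ T} {p₂ : Q ⇒ B} →
                        IsPullback t b p₁ p₂ → Surjective b → Surjective p₁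
  pullback-surjective isPullback b-surj x =
    let (u , bu≈tx) = b-surj (_ ∘ x)
    in univ x u (sym bu≈tx) , univ₁ (sym bu≈tx)
    where open PullbackOps isPullback

  -- Choice objects are projective: an arrow out of a choice object lifts along
  -- any surjection (split the pullback of the surjection along it).
  choice-lift : ∀ {T B K} → IsChoiceObject T → (b : B ⇒ K) → Surjective b →
                (t : T ⇒ K) → Σ[ u ∈ T ⇒ B ] (b ∘ u ≈ t)
  choice-lift T-choice b b-surj t =
    let (s , p₁s≈id) = T-choice p₁ (pullback-surjective isPullback b-surj)
    in p₂ ∘ s , (begin
      b ∘ (p₂ ∘ s)  ≈⟨ extend commute ⟨
      t ∘ (p₁ ∘ s)  ≈⟨ refl⟩∘⟨ p₁s≈id ⟩
      t ∘ id        ≈⟨ identityʳ ⟩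
      t             ∎)
    where open Pullback (pb t b)

  -- By the strong-generator axiom, an arrow whose elements all lie in the image
  -- of a mono m factors through m: the pullback of m along it is bijective on elements.
  factor-through-mono : ∀ {N Z T} (m : N ⇒ Z) → Mono m → (v : T ⇒ Z) →
                        (∀ (t : Elt T) → (v ∘ t) ∈[ m ]) → Σ[ d ∈ T ⇒ N ] (m ∘ d ≈ v)
  factor-through-mono {T = T} m m-mono v v-in-m =
    let (p₁⁻¹ , _ , p₁p₁⁻¹≈id) = C4-generator p₁ p₁-bijective
    in p₂ ∘ p₁⁻¹ , trans (m-p₂ p₁⁻¹) (trans (refl⟩∘⟨ p₁p₁⁻¹≈id) identityʳ)
    where
    open Pullback (pb v m)

    m-p₂ : ∀ {X} (x : X ⇒ P) → m ∘ (p₂ ∘ x) ≈ v ∘ (p₁ ∘ x)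
    m-p₂ x = sym (extend commute)

    p₁-bijective : ∀ (t : Elt T) →
                   Σ[ w ∈ Elt P ] (p₁ ∘ w ≈ t × (∀ w' → p₁ ∘ w' ≈ t → w' ≈ w))
    p₁-bijective t =
      let (n , mn≈vt) = v-in-m t
          w = univ t n (sym mn≈vt)
          p₁w≈t = univ₁ (sym mn≈vt)
      in w , p₁w≈t , λ w' p₁w'≈t →
        let p₁w'≈p₁w = trans p₁w'≈t (sym p₁w≈t)
        in jointly-monic w' w p₁w'≈p₁w
             (m-mono _ _ (trans (m-p₂ w') (trans (refl⟩∘⟨ p₁w'≈p₁w) (sym (m-p₂ w)))))

  -- Coequalisers are surjective: the coequaliser factors through the image of its
  -- own quotient arrow, so that image (a mono) is split epi, hence an isomorphism.
  coequaliser-surjective : ∀ {A B} {f g : A ⇒ B} (Cq : Coequaliser f g) →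
                           Surjective (Coequaliser.arr Cq)
  coequaliser-surjective {f = f} {g} Cq z =
    let (w , pw≈uz) = p-surjective (u ∘ z)
    in w , (begin
      arr ∘ w        ≈⟨ factorisation ⟩∘⟨refl ⟨
      (m ∘ p) ∘ w    ≈⟨ pullʳ pw≈uz ⟩
      m ∘ (u ∘ z)    ≈⟨ pullˡ mu≈id ⟩
      id ∘ z         ≈⟨ identityˡ ⟩
      z              ∎)
    where
    open CoequaliserOps Cq
    open Image (image arr)

    p-coequalises : p ∘ f ≈ p ∘ g
    p-coequalises =
      m-mono _ _ (trans (pullˡ factorisation) (trans equality (sym (pullˡ factorisation))))

    u : Q ⇒ I
    u = ind p p-coequalises

    mu≈id : m ∘ u ≈ id
    mu≈id = epi (trans (pullʳ (ind-β p-coequalises)) (trans factorisation (sym identityˡ)))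

  𝟏-choice : IsChoiceObject 𝟏
  𝟏-choice a a-surjective = a-surjective id

  -- If φ : F → I of a dependent product of Y --g--> X --f--> I has a section σ, then g
  -- has a section: over x take the unique y with ⟨σ (f x), x, y⟩ ∈ α.  Concretely, the
  -- part E of α where the first component is σ ∘ f of the second maps bijectively,
  -- hence (strong generator) isomorphically, onto X; its third component is the section.
  dependent-product-section : ∀ {Y X I} {g : Y ⇒ X} {f : X ⇒ I} (Π : DependentProduct g f) →
    (σ : I ⇒ DependentProduct.F Π) → DependentProduct.φ Π ∘ σ ≈ id →
    Σ[ s ∈ X ⇒ Y ] (g ∘ s ≈ id)
  dependent-product-section {X = X} {g = g} {f} Π σ φσ≈id = α₃ ∘ (ι ∘ h⁻¹) , (begin
      g ∘ (α₃ ∘ (ι ∘ h⁻¹))  ≈⟨ pullˡ α-graph ⟩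
      α₂ ∘ (ι ∘ h⁻¹)        ≈⟨ sym-assoc ⟩
      h ∘ h⁻¹               ≈⟨ hh⁻¹≈id ⟩
      id                    ∎)
    where
    open DependentProduct Π
    S : Equaliser α₁ (σ ∘ (f ∘ α₂))
    S = equalisers α₁ (σ ∘ (f ∘ α₂))
    open Equaliser S using (E)
      renaming (arr to ι; equality to ι-equality; universal to ι-universal)

    h : E ⇒ X
    h = α₂ ∘ ι

    α-graph : g ∘ α₃ ≈ α₂
    α-graph = C4-separating _ _ λ p → trans assoc (ax-graph _ _ _ (p , refl , refl , refl))

    α₁e : ∀ {T} (w : T ⇒ E) → α₁ ∘ (ι ∘ w) ≈ σ ∘ (f ∘ (h ∘ w))
    α₁e w = trans (extend ι-equality) (trans assoc (refl⟩∘⟨ trans assoc (refl⟩∘⟨ sym-assoc)))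

    over-σ : ∀ (x : Elt X) → f ∘ x ≈ φ ∘ (σ ∘ (f ∘ x))
    over-σ x = sym (trans (pullˡ φσ≈id) identityˡ)

    h-bijective : ∀ (x : Elt X) → Σ[ v ∈ Elt E ] (h ∘ v ≈ x × (∀ v' → h ∘ v' ≈ x → v' ≈ v))
    h-bijective x with proj₁ (ax-total (σ ∘ (f ∘ x)) x) (over-σ x)
    ... | _ , u , α₁u≈c , α₂u≈x , _ = v , hv≈x , unique
      where
      u-in-E : α₁ ∘ u ≈ (σ ∘ (f ∘ α₂)) ∘ u
      u-in-E = trans α₁u≈c (sym (trans assoc (refl⟩∘⟨ pullʳ α₂u≈x)))

      v : Elt E
      v = proj₁ (ι-universal u u-in-E)

      hv≈x : h ∘ v ≈ x
      hv≈x = trans (pullʳ (proj₁ (proj₂ (ι-universal u u-in-E)))) α₂u≈x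

      unique : ∀ v' → h ∘ v' ≈ x → v' ≈ v
      unique v' hv'≈x = equaliser-mono S v' v (α-mono (ι ∘ v') (ι ∘ v) α₁-eq α₂-eq α₃-eq)
        where
        hv'≈hv : h ∘ v' ≈ h ∘ v
        hv'≈hv = trans hv'≈x (sym hv≈x)
        α₁-eq : α₁ ∘ (ι ∘ v') ≈ α₁ ∘ (ι ∘ v)
        α₁-eq = trans (α₁e v') (trans (refl⟩∘⟨ refl⟩∘⟨ hv'≈hv) (sym (α₁e v)))
        α₂-eq : α₂ ∘ (ι ∘ v') ≈ α₂ ∘ (ι ∘ v)
        α₂-eq = trans sym-assoc (trans hv'≈hv assoc)
        α₃-eq : α₃ ∘ (ι ∘ v') ≈ α₃ ∘ (ι ∘ v)
        α₃-eq = ax-functional _ _ _ _ _ (ι ∘ v' , α₁-eq , refl , refl)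
                                        (ι ∘ v , refl , refl , refl) α₂-eq

    h-iso : IsIso h
    h-iso = C4-generator h h-bijective

    h⁻¹ : X ⇒ E
    h⁻¹ = proj₁ h-iso

    hh⁻¹≈id : h ∘ h⁻¹ ≈ id
    hh⁻¹≈id = proj₂ (proj₂ h-iso)

  -- Let q : S ↠ A × B with B a choice object.  For each i ∈ A, lifting the fibre
  -- inclusion ⟨i,id⟩ : B → A × B along q gives a section of q over {i} × B, i.e. an
  -- element over i of the dependent product of q along π₁.
  product-fibre-sections : ∀ {A B S} → IsChoiceObject B →
    (q : S ⇒ Product.A×B (products A B)) → Surjective q →
    Surjective (DependentProduct.φ (C2 q (Product.π₁ (products A B))))
  product-fibre-sections {A} {B} {S} B-choice q q-surjective i =
    let (c , (φc≈i , _) , _) = universal j s j-s-jointly-monic i graph total functional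
    in c , φc≈i
    where
    open ProductOps (products A B)
    open DependentProduct (C2 q π₁)

    j : B ⇒ A×B
    j = ⟨ i ∘ ! , id ⟩

    s : B ⇒ S
    s = proj₁ (choice-lift B-choice q q-surjective j)

    qs≈j : q ∘ s ≈ j
    qs≈j = proj₂ (choice-lift B-choice q q-surjective j)

    j-mono : Mono j
    j-mono = retraction⇒mono project₂

    j-s-jointly-monic : JointlyMonic₂ j s
    j-s-jointly-monic g h e₁ _ = j-mono g h e₁

    π₁j : ∀ (u : Elt B) → π₁ ∘ (j ∘ u) ≈ i
    π₁j u = trans (pullˡ project₁) (trans assoc (trans (refl⟩∘⟨ !-elt u) identityʳ))

    graph : ∀ x y → ⟨ x , y ⟩∈[ j , s ] → q ∘ y ≈ x
    graph x y (u , ju≈x , su≈y) = trans (refl⟩∘⟨ sym su≈y) (trans (pullˡ qs≈j) ju≈x)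

    total : ∀ x → (π₁ ∘ x ≈ i) ⇔ (Σ[ y ∈ Elt S ] ⟨ x , y ⟩∈[ j , s ])
    total x = into-fibre , from-fibre
      where
      into-fibre : π₁ ∘ x ≈ i → Σ[ y ∈ Elt S ] ⟨ x , y ⟩∈[ j , s ]
      into-fibre π₁x≈i = s ∘ (π₂ ∘ x) , π₂ ∘ x ,
        ext (trans (π₁j (π₂ ∘ x)) (sym π₁x≈i)) (trans (pullˡ project₂) identityˡ) , refl
      from-fibre : (Σ[ y ∈ Elt S ] ⟨ x , y ⟩∈[ j , s ]) → π₁ ∘ x ≈ i
      from-fibre (_ , u , ju≈x , _) = trans (refl⟩∘⟨ sym ju≈x) (π₁j u)

    functional : ∀ x y y' → ⟨ x , y ⟩∈[ j , s ] → ⟨ x , y' ⟩∈[ j , s ] → y ≈ y'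
    functional x y y' (u , ju≈x , su≈y) (u' , ju'≈x , su'≈y') =
      trans (sym su≈y) (trans (refl⟩∘⟨ j-mono u u' (trans ju≈x (sym ju'≈x))) su'≈y')

  product-choice : ∀ {A B} → IsChoiceObject A → IsChoiceObject B →
                   IsChoiceObject (Product.A×B (products A B))
  product-choice {A} {B} A-choice B-choice q q-surjective =
    let Π = C2 q (Product.π₁ (products A B))
        (σ , φσ≈id) = A-choice (DependentProduct.φ Π)
                               (product-fibre-sections B-choice q q-surjective)
    in dependent-product-section Π σ φσ≈id

  Ch : Category (o ⊔ ℓ ⊔ e) ℓ e
  Ch = ChoiceObjects 𝓔 M

  module Ch where
    open Category Ch public
    open Notions Ch public

  choice-finite-products : Ch.HasFiniteProducts
  choice-finite-products =
    record { ⊤ = 𝟏 , 𝟏-choice ; ! = ! ; !-unique = !-unique } , choice-product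
    where
    choice-product : ∀ A B → Ch.Product A B
    choice-product (A , A-choice) (B , B-choice) = record
      { A×B = A×B , product-choice A-choice B-choice
      ; π₁ = π₁ ; π₂ = π₂ ; ⟨_,_⟩ = ⟨_,_⟩
      ; project₁ = project₁ ; project₂ = project₂ ; unique = unique }
      where open Product (products A B)

  -- A choice cover of the equaliser of f and g is a weak equaliser in Ch: maps from
  -- choice objects into the equaliser lift along the cover.
  choice-weak-equalisers : Ch.HasWeakEqualisers
  choice-weak-equalisers f g = record
    { E = A , A-choice
    ; arr = arr ∘ cover
    ; equality = extend equality
    ; universal = λ {T} h fh≈gh →
        let (u , arr-u≈h , _) = universal h fh≈gh
            (v , cover-v≈u) = choice-lift (proj₂ T) cover cover-surjective u
        in v , trans (pullʳ cover-v≈u) arr-u≈h }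
    where
    open Equaliser (equalisers f g)
    open ChoiceCover (choice-cover E)

  choice-weak-pullback : ∀ {A B Z : Ch.Obj} (f : A Ch.⇒ Z) (g : B Ch.⇒ Z) →
    Σ[ Q ∈ Ch.Obj ] Σ[ q₁ ∈ Q Ch.⇒ A ] Σ[ q₂ ∈ Q Ch.⇒ B ]
      Ch.IsWeakPullback {A} {B} {Z} {Q} f g q₁ q₂
  choice-weak-pullback f g =
    (A , A-choice) , p₁ ∘ cover , p₂ ∘ cover , extend commute ,
    λ {T} a b fa≈gb →
      let (v , cover-v≈u) = choice-lift (proj₂ T) cover cover-surjective (univ a b fa≈gb)
      in v , trans (pullʳ cover-v≈u) (univ₁ fa≈gb) , trans (pullʳ cover-v≈u) (univ₂ fa≈gb)
    where
    open Pullback (pb f g)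
    open ChoiceCover (choice-cover P)

  open ExactCompletion Ch using (PER; ExHom; _∼_; Ex)
  module Ex = Category Ex

  -- Every object E is presented by choice objects: a cover a : A ↠ E and a cover
  -- b : B ↠ A ×_E A of the kernel pair of a, giving r₁, r₂ : B ⇒ A.  Any two maps from
  -- a choice object identified by a are related through B (kernel-lift); this makes
  -- ⟨r₁,r₂⟩ a pseudo-equivalence relation in Ch.
  module Presentation (E : Obj) where
    open ChoiceCover (choice-cover E) public
      renaming (cover to a; cover-surjective to a-surjective)
    private module K = Pullback (pb a a)
    open ChoiceCover (choice-cover K.P) public using ()
      renaming (A to B; A-choice to B-choice; cover to b; cover-surjective to b-surjective)

    r₁ r₂ : B ⇒ A
    r₁ = K.p₁ ∘ b
    r₂ = K.p₂ ∘ b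

    a-r : a ∘ r₁ ≈ a ∘ r₂
    a-r = extend K.commute

    kernel-lift : ∀ {T} → IsChoiceObject T → (u v : T ⇒ A) → a ∘ u ≈ a ∘ v →
                  Σ[ h ∈ T ⇒ B ] (r₁ ∘ h ≈ u × r₂ ∘ h ≈ v)
    kernel-lift T-choice u v au≈av =
      let (h , bh≈k) = choice-lift T-choice b b-surjective (K.univ u v au≈av)
      in h , trans (pullʳ bh≈k) (K.univ₁ au≈av) , trans (pullʳ bh≈k) (K.univ₂ au≈av)

    per : PER
    per =
      let (ρ , ρ₁ , ρ₂) = kernel-lift A-choice id id refl
          (σ , σ₁ , σ₂) = kernel-lift B-choice r₂ r₁ (sym a-r)
          (Q , q₁ , q₂ , Q-wpb) =
            choice-weak-pullback {B , B-choice} {B , B-choice} {A , A-choice} r₂ r₁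
          composable : a ∘ (r₁ ∘ q₁) ≈ a ∘ (r₂ ∘ q₂)
          composable = begin
            a ∘ (r₁ ∘ q₁)  ≈⟨ extend a-r ⟩
            a ∘ (r₂ ∘ q₁)  ≈⟨ refl⟩∘⟨ proj₁ Q-wpb ⟩
            a ∘ (r₁ ∘ q₂)  ≈⟨ extend a-r ⟩
            a ∘ (r₂ ∘ q₂)  ∎
          (τ , τ₁ , τ₂) = kernel-lift (proj₂ Q) (r₁ ∘ q₁) (r₂ ∘ q₂) composable
      in record
        { X = A , A-choice ; R = B , B-choice ; r₁ = r₁ ; r₂ = r₂
        ; ρ = ρ ; ρ₁ = ρ₁ ; ρ₂ = ρ₂ ; σ = σ ; σ₁ = σ₁ ; σ₂ = σ₂
        ; Q = Q ; q₁ = q₁ ; q₂ = q₂ ; Q-wpb = Q-wpb ; τ = τ ; τ₁ = τ₁ ; τ₂ = τ₂ }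

  F₀ : Obj → PER
  F₀ E = Presentation.per E

  -- An arrow f : E → E' is tracked by a lift f' : A → A' of f ∘ a along the cover a';
  -- it respects the presenting relations since a' f' r₁ ≈ f a r₁ ≈ f a r₂ ≈ a' f' r₂.
  module Track {E E'} (f : E ⇒ E') where
    private
      module S = Presentation E
      module T = Presentation E'
      lifted : Σ[ u ∈ S.A ⇒ T.A ] (T.a ∘ u ≈ f ∘ S.a)
      lifted = choice-lift S.A-choice T.a T.a-surjective (f ∘ S.a)

    f' : S.A ⇒ T.A
    f' = proj₁ lifted

    a'f'≈fa : T.a ∘ f' ≈ f ∘ S.a
    a'f'≈fa = proj₂ lifted

    F₁ : ExHom (F₀ E) (F₀ E')
    F₁ =
      let (f̂ , f̂₁ , f̂₂) = T.kernel-lift S.B-choice (f' ∘ S.r₁) (f' ∘ S.r₂) (begin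
            T.a ∘ (f' ∘ S.r₁)  ≈⟨ pullˡ a'f'≈fa ⟩
            (f ∘ S.a) ∘ S.r₁   ≈⟨ pullʳ S.a-r ⟩
            f ∘ (S.a ∘ S.r₂)   ≈⟨ sym-assoc ⟩
            (f ∘ S.a) ∘ S.r₂   ≈⟨ pullˡ a'f'≈fa ⟨
            T.a ∘ (f' ∘ S.r₂)  ∎)
      in record { f = f' ; f̂ = f̂ ; f̂₁ = f̂₁ ; f̂₂ = f̂₂ }

  open Track using (F₁)

  ∼-by-cover : ∀ {E E'} (G H : ExHom (F₀ E) (F₀ E')) →
               Presentation.a E' ∘ ExHom.f G ≈ Presentation.a E' ∘ ExHom.f H → G ∼ H
  ∼-by-cover {E} {E'} G H =
    Presentation.kernel-lift E' (Presentation.A-choice E) (ExHom.f G) (ExHom.f H)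

  Ffun : Functor 𝓔 Ex
  Ffun = record
    { F₀ = F₀
    ; F₁ = F₁
    ; identity = ∼-by-cover (F₁ id) Ex.id
        (trans (Track.a'f'≈fa id) (trans identityˡ (sym identityʳ)))
    ; homomorphism = λ {_} {_} {_} {f} {g} → ∼-by-cover (F₁ (g ∘ f)) (F₁ g Ex.∘ F₁ f)
        (trans (Track.a'f'≈fa (g ∘ f))
          (trans assoc (sym (trans (pullˡ (Track.a'f'≈fa g))
            (pullʳ (Track.a'f'≈fa f))))))
    ; F-resp-≈ = λ {_} {_} {f} {g} f≈g → ∼-by-cover (F₁ f) (F₁ g)
        (trans (Track.a'f'≈fa f) (trans (f≈g ⟩∘⟨refl) (sym (Track.a'f'≈fa g))))
    }

  module Quotient (r : PER) = CoequaliserOps (coequalisers (PER.r₁ r) (PER.r₂ r))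

  G₀ : PER → Obj
  G₀ r = Quotient.Q r

  module Induced {r s : PER} (φ : ExHom r s) where
    private
      module r = PER r
      module s = PER s
      module φ = ExHom φ

      respects : (Quotient.arr s ∘ φ.f) ∘ r.r₁ ≈ (Quotient.arr s ∘ φ.f) ∘ r.r₂
      respects = begin
        (Quotient.arr s ∘ φ.f) ∘ r.r₁   ≈⟨ assoc ⟩
        Quotient.arr s ∘ (φ.f ∘ r.r₁)   ≈⟨ refl⟩∘⟨ φ.f̂₁ ⟨
        Quotient.arr s ∘ (s.r₁ ∘ φ.f̂)  ≈⟨ extend (Quotient.equality s) ⟩
        Quotient.arr s ∘ (s.r₂ ∘ φ.f̂)  ≈⟨ refl⟩∘⟨ φ.f̂₂ ⟩
        Quotient.arr s ∘ (φ.f ∘ r.r₂)   ≈⟨ sym-assoc ⟩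
        (Quotient.arr s ∘ φ.f) ∘ r.r₂   ∎

    G₁ : G₀ r ⇒ G₀ s
    G₁ = Quotient.ind r (Quotient.arr s ∘ φ.f) respects

    β : G₁ ∘ Quotient.arr r ≈ Quotient.arr s ∘ φ.f
    β = Quotient.ind-β r respects

  open Induced using (G₁)

  Gfun : Functor Ex 𝓔
  Gfun = record
    { F₀ = G₀
    ; F₁ = G₁
    ; identity = λ {r} → Quotient.epi r
        (trans (Induced.β (Ex.id {r})) (trans identityʳ (sym identityˡ)))
    ; homomorphism = λ {r} {_} {_} {φ} {ψ} → Quotient.epi r
        (trans (Induced.β (ψ Ex.∘ φ)) (trans sym-assoc (sym (trans (pullʳ (Induced.β φ))
          (trans sym-assoc (Induced.β ψ ⟩∘⟨refl))))))
    ; F-resp-≈ = λ {r} {s} {φ} {ψ} (h , h₁ , h₂) → Quotient.epi r (begin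
        G₁ φ ∘ Quotient.arr r                 ≈⟨ Induced.β φ ⟩
        Quotient.arr s ∘ ExHom.f φ            ≈⟨ refl⟩∘⟨ h₁ ⟨
        Quotient.arr s ∘ (PER.r₁ s ∘ h)       ≈⟨ extend (Quotient.equality s) ⟩
        Quotient.arr s ∘ (PER.r₂ s ∘ h)       ≈⟨ refl⟩∘⟨ h₂ ⟩
        Quotient.arr s ∘ ExHom.f ψ            ≈⟨ Induced.β ψ ⟨
        G₁ ψ ∘ Quotient.arr r                 ∎)
    }

  -- Pseudo-equivalence relations of choice objects are effective: maps u, v from a
  -- choice object identified by the quotient of Y are related by Y.  The image of
  -- ⟨r₁,r₂⟩ is an equivalence relation, hence (C10) the kernel pair of some g; g
  -- coequalises r₁, r₂, so g u ≈ g v, and R covers the image.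
  module Effective (Y : PER) where
    open PER Y
    open ProductOps (products (proj₁ X) (proj₁ X))
    open Image (image ⟨ r₁ , r₂ ⟩) renaming (I to Im)
    private module Cq = Quotient Y

    m₁ m₂ : Im ⇒ proj₁ X
    m₁ = π₁ ∘ m
    m₂ = π₂ ∘ m

    m₁p≈r₁ : m₁ ∘ p ≈ r₁
    m₁p≈r₁ = trans assoc (trans (refl⟩∘⟨ factorisation) project₁)

    m₂p≈r₂ : m₂ ∘ p ≈ r₂
    m₂p≈r₂ = trans assoc (trans (refl⟩∘⟨ factorisation) project₂)

    from-image : ∀ (t : Elt Im) →
                 Σ[ s ∈ Elt (proj₁ R) ] (r₁ ∘ s ≈ m₁ ∘ t × r₂ ∘ s ≈ m₂ ∘ t)
    from-image t =
      let (s , ps≈t) = p-surjective t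
      in s , trans (sym m₁p≈r₁ ⟩∘⟨refl) (pullʳ ps≈t) , trans (sym m₂p≈r₂ ⟩∘⟨refl) (pullʳ ps≈t)

    into-image : ∀ {T} (u v : T ⇒ proj₁ X) →
      (∀ (t : Elt T) → Σ[ s ∈ Elt (proj₁ R) ] (r₁ ∘ s ≈ u ∘ t × r₂ ∘ s ≈ v ∘ t)) →
      Σ[ d ∈ T ⇒ Im ] (m₁ ∘ d ≈ u × m₂ ∘ d ≈ v)
    into-image u v related =
      let (d , md≈uv) = factor-through-mono m m-mono ⟨ u , v ⟩ in-image
      in d , trans (pullʳ md≈uv) project₁ , trans (pullʳ md≈uv) project₂
      where
      in-image : ∀ t → (⟨ u , v ⟩ ∘ t) ∈[ m ]
      in-image t =
        let (s , r₁s≈ut , r₂s≈vt) = related t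
        in p ∘ s , ext
          (trans sym-assoc (trans (pullˡ m₁p≈r₁) (trans r₁s≈ut (sym (pullˡ project₁)))))
          (trans sym-assoc (trans (pullˡ m₂p≈r₂) (trans r₂s≈vt (sym (pullˡ project₂)))))

    image-symmetric : Σ[ σ' ∈ Im ⇒ Im ] (m₁ ∘ σ' ≈ m₂ × m₂ ∘ σ' ≈ m₁)
    image-symmetric = into-image m₂ m₁ λ t →
      let (s , r₁s≈m₁t , r₂s≈m₂t) = from-image t
      in σ ∘ s , trans (pullˡ σ₁) r₂s≈m₂t , trans (pullˡ σ₂) r₁s≈m₁t

    image-transitive : ∀ {P} (p₁ p₂ : P ⇒ Im) → IsPullback m₂ m₁ p₁ p₂ →
                       Σ[ τ' ∈ P ⇒ Im ] (m₁ ∘ τ' ≈ m₁ ∘ p₁ × m₂ ∘ τ' ≈ m₂ ∘ p₂)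
    image-transitive p₁ p₂ isPullback = into-image (m₁ ∘ p₁) (m₂ ∘ p₂) λ w →
      let (s , r₁s≈ , r₂s≈) = from-image (p₁ ∘ w)
          (s' , r₁s'≈ , r₂s'≈) = from-image (p₂ ∘ w)
          composable : r₂ ∘ s ≈ r₁ ∘ s'
          composable = trans r₂s≈ (trans (extend (proj₁ isPullback)) (sym r₁s'≈))
          (t , q₁t≈s , q₂t≈s') = proj₂ Q-wpb {𝟏 , 𝟏-choice} s s' composable
      in τ ∘ t ,
         trans (pullˡ τ₁) (trans (pullʳ q₁t≈s) (trans r₁s≈ sym-assoc)) ,
         trans (pullˡ τ₂) (trans (pullʳ q₂t≈s') (trans r₂s'≈ sym-assoc))

    image-equivalence : IsEquivalenceRelation m₁ m₂
    image-equivalence =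
      (λ g h m₁g≈m₁h m₂g≈m₂h → m-mono g h (ext (trans sym-assoc (trans m₁g≈m₁h assoc))
                                               (trans sym-assoc (trans m₂g≈m₂h assoc)))) ,
      (p ∘ ρ , trans (pullˡ m₁p≈r₁) ρ₁ , trans (pullˡ m₂p≈r₂) ρ₂) ,
      image-symmetric ,
      image-transitive

    private
      kernel : IsKernelPair m₁ m₂
      kernel = C10 m₁ m₂ image-equivalence

      g : proj₁ X ⇒ proj₁ kernel
      g = proj₁ (proj₂ kernel)

      module Kernel = PullbackOps (proj₂ (proj₂ kernel))

      g-coequalises : g ∘ r₁ ≈ g ∘ r₂
      g-coequalises = begin
        g ∘ r₁         ≈⟨ refl⟩∘⟨ m₁p≈r₁ ⟨
        g ∘ (m₁ ∘ p)   ≈⟨ extend Kernel.commute ⟩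
        g ∘ (m₂ ∘ p)   ≈⟨ refl⟩∘⟨ m₂p≈r₂ ⟩
        g ∘ r₂         ∎

    effective : ∀ {T} → IsChoiceObject T → (u v : T ⇒ proj₁ X) → Cq.arr ∘ u ≈ Cq.arr ∘ v →
                Σ[ h ∈ T ⇒ proj₁ R ] (r₁ ∘ h ≈ u × r₂ ∘ h ≈ v)
    effective T-choice u v cu≈cv =
      let (h , ph≈d) = choice-lift T-choice p p-surjective (Kernel.univ u v gu≈gv)
      in h , trans (sym m₁p≈r₁ ⟩∘⟨refl) (trans (pullʳ ph≈d) (Kernel.univ₁ gu≈gv)) ,
             trans (sym m₂p≈r₂ ⟩∘⟨refl) (trans (pullʳ ph≈d) (Kernel.univ₂ gu≈gv))
      where
      k-β : Cq.ind g g-coequalises ∘ Cq.arr ≈ g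
      k-β = Cq.ind-β g-coequalises
      gu≈gv : g ∘ u ≈ g ∘ v
      gu≈gv = trans (sym k-β ⟩∘⟨refl) (trans (pullʳ cu≈cv) (pullˡ k-β))

  -- G (F E) ≅ E: the arrow η induced by the cover a on the quotient of its presentation
  -- is surjective (as a is) and injective on elements (by kernel-lift at 𝟏), hence an
  -- isomorphism by the strong-generator axiom.
  module Unit (E : Obj) where
    private
      module P = Presentation E
      module Cq = Quotient (F₀ E)

    η : G₀ (F₀ E) ⇒ E
    η = Cq.ind P.a P.a-r

    η-β : η ∘ Cq.arr ≈ P.a
    η-β = Cq.ind-β P.a-r

    η-bijective : ∀ (y : Elt E) →
      Σ[ x ∈ Elt (G₀ (F₀ E)) ] (η ∘ x ≈ y × (∀ x' → η ∘ x' ≈ y → x' ≈ x))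
    η-bijective y =
      let (u , au≈y) = P.a-surjective y
      in Cq.arr ∘ u , trans (pullˡ η-β) au≈y , λ x' ηx'≈y →
        let (u' , cu'≈x') = coequaliser-surjective (coequalisers P.r₁ P.r₂) x'
            au'≈au = trans (sym η-β ⟩∘⟨refl) (trans (pullʳ cu'≈x') (trans ηx'≈y (sym au≈y)))
            (h , r₁h≈u' , r₂h≈u) = P.kernel-lift 𝟏-choice u' u au'≈au
        in begin
          x'                       ≈⟨ cu'≈x' ⟨
          Cq.arr ∘ u'              ≈⟨ refl⟩∘⟨ r₁h≈u' ⟨
          Cq.arr ∘ (P.r₁ ∘ h)      ≈⟨ extend Cq.equality ⟩
          Cq.arr ∘ (P.r₂ ∘ h)      ≈⟨ refl⟩∘⟨ r₂h≈u ⟩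
          Cq.arr ∘ u               ∎

    private
      η-iso : IsIso η
      η-iso = C4-generator η η-bijective

    η⁻¹ : E ⇒ G₀ (F₀ E)
    η⁻¹ = proj₁ η-iso

    η-iso₁ : η ∘ η⁻¹ ≈ id
    η-iso₁ = proj₂ (proj₂ η-iso)

    η-iso₂ : η⁻¹ ∘ η ≈ id
    η-iso₂ = proj₁ (proj₂ η-iso)

  η-natural : ∀ {E E'} (f : E ⇒ E') →
              Unit.η E' ∘ G₁ {F₀ E} {F₀ E'} (F₁ {E} {E'} f) ≈ f ∘ Unit.η E
  η-natural {E} {E'} f = Quotient.epi (F₀ E) (begin
    (Unit.η E' ∘ G₁ (F₁ f)) ∘ Quotient.arr (F₀ E)  ≈⟨ pullʳ (Induced.β (F₁ f)) ⟩
    Unit.η E' ∘ (Quotient.arr (F₀ E') ∘ Track.f' f) ≈⟨ pullˡ (Unit.η-β E') ⟩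
    Presentation.a E' ∘ Track.f' f                  ≈⟨ Track.a'f'≈fa f ⟩
    f ∘ Presentation.a E                            ≈⟨ pullʳ (Unit.η-β E) ⟨
    (f ∘ Unit.η E) ∘ Quotient.arr (F₀ E)            ∎)

  -- The quotient arrow c : X ↠ G₀ Y and the presenting cover
  -- a : A ↠ G₀ Y lift along each other (both sources are choice objects); the lifts
  -- respect the relations and are mutually inverse up to the relations, by
  -- effectiveness of Y and by kernel-lift for the presentation.
  -- Objects are written Functor.F₀ Gfun Y rather than the definitionally equal G₀ Y so
  -- that these types agree literally with the fields of Equivalence.
  module Counit (Y : PER) where
    private
      module Y = PER Y
      module P = Presentation (Functor.F₀ Gfun Y)
      module Cq = Quotient Y
      lift-a : Σ[ u ∈ P.A ⇒ proj₁ Y.X ] (Cq.arr ∘ u ≈ P.a)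
      lift-a = choice-lift P.A-choice Cq.arr
                 (coequaliser-surjective (coequalisers Y.r₁ Y.r₂)) P.a

      lift-c : Σ[ u ∈ proj₁ Y.X ⇒ P.A ] (P.a ∘ u ≈ Cq.arr)
      lift-c = choice-lift (proj₂ Y.X) P.a P.a-surjective Cq.arr

    f : P.A ⇒ proj₁ Y.X
    f = proj₁ lift-a

    cf≈a : Cq.arr ∘ f ≈ P.a
    cf≈a = proj₂ lift-a

    g : proj₁ Y.X ⇒ P.A
    g = proj₁ lift-c

    ag≈c : P.a ∘ g ≈ Cq.arr
    ag≈c = proj₂ lift-c

    ε : ExHom (Functor.F₀ Ffun (Functor.F₀ Gfun Y)) Y
    ε =
      let (f̂ , f̂₁ , f̂₂) = Effective.effective Y P.B-choice (f ∘ P.r₁) (f ∘ P.r₂)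
                            (trans (pullˡ cf≈a) (trans P.a-r (sym (pullˡ cf≈a))))
      in record { f = f ; f̂ = f̂ ; f̂₁ = f̂₁ ; f̂₂ = f̂₂ }

    ε⁻¹ : ExHom Y (Functor.F₀ Ffun (Functor.F₀ Gfun Y))
    ε⁻¹ =
      let (ĝ , ĝ₁ , ĝ₂) = P.kernel-lift (proj₂ Y.R) (g ∘ Y.r₁) (g ∘ Y.r₂)
                            (trans (pullˡ ag≈c) (trans Cq.equality (sym (pullˡ ag≈c))))
      in record { f = g ; f̂ = ĝ ; f̂₁ = ĝ₁ ; f̂₂ = ĝ₂ }

    ε-iso₁ : Ex._≈_ {Y} {Y}
               (Ex._∘_ {Y} {Functor.F₀ Ffun (Functor.F₀ Gfun Y)} {Y} ε ε⁻¹) (Ex.id {Y})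
    ε-iso₁ = Effective.effective Y (proj₂ Y.X) (f ∘ g) id
               (trans (pullˡ cf≈a) (trans ag≈c (sym identityʳ)))

    ε-iso₂ : Ex._≈_ {Functor.F₀ Ffun (Functor.F₀ Gfun Y)}
                    {Functor.F₀ Ffun (Functor.F₀ Gfun Y)}
               (Ex._∘_ {Functor.F₀ Ffun (Functor.F₀ Gfun Y)} {Y}
                       {Functor.F₀ Ffun (Functor.F₀ Gfun Y)} ε⁻¹ ε)
               (Ex.id {Functor.F₀ Ffun (Functor.F₀ Gfun Y)})
    ε-iso₂ = P.kernel-lift P.A-choice (g ∘ f) id
               (trans (pullˡ ag≈c) (trans cf≈a (sym identityʳ)))

  ε-natural : ∀ {Y Z} (φ : ExHom Y Z) →
    Ex._≈_ {Functor.F₀ Ffun (Functor.F₀ Gfun Y)} {Z}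
      (Ex._∘_ {Functor.F₀ Ffun (Functor.F₀ Gfun Y)}
              {Functor.F₀ Ffun (Functor.F₀ Gfun Z)} {Z}
         (Counit.ε Z)
         (Functor.F₁ Ffun {Functor.F₀ Gfun Y} {Functor.F₀ Gfun Z} (Functor.F₁ Gfun {Y} {Z} φ)))
      (Ex._∘_ {Functor.F₀ Ffun (Functor.F₀ Gfun Y)} {Y} {Z} φ (Counit.ε Y))
  ε-natural {Y} {Z} φ =
    Effective.effective Z (Presentation.A-choice (Functor.F₀ Gfun Y))
      (fZ ∘ φ') (ExHom.f φ ∘ fY)
      (begin
        Quotient.arr Z ∘ (fZ ∘ φ')                  ≈⟨ pullˡ (Counit.cf≈a Z) ⟩
        Presentation.a (Functor.F₀ Gfun Z) ∘ φ'      ≈⟨ Track.a'f'≈fa Gφ ⟩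
        Gφ ∘ Presentation.a (Functor.F₀ Gfun Y)      ≈⟨ refl⟩∘⟨ Counit.cf≈a Y ⟨
        Gφ ∘ (Quotient.arr Y ∘ fY)                  ≈⟨ pullˡ (Induced.β φ) ⟩
        (Quotient.arr Z ∘ ExHom.f φ) ∘ fY           ≈⟨ assoc ⟩
        Quotient.arr Z ∘ (ExHom.f φ ∘ fY)           ∎)
    where
    Gφ : Functor.F₀ Gfun Y ⇒ Functor.F₀ Gfun Z
    Gφ = Functor.F₁ Gfun φ

    φ' : Presentation.A (Functor.F₀ Gfun Y) ⇒ Presentation.A (Functor.F₀ Gfun Z)
    φ' = Track.f' Gφ

    fY : Presentation.A (Functor.F₀ Gfun Y) ⇒ proj₁ (PER.X Y)
    fY = Counit.f Y

    fZ : Presentation.A (Functor.F₀ Gfun Z) ⇒ proj₁ (PER.X Z)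
    fZ = Counit.f Z

  equivalence : Equivalence 𝓔 Ex
  equivalence = record
    { F = Ffun
    ; G = Gfun
    ; η = Unit.η
    ; η⁻¹ = Unit.η⁻¹
    ; η-iso₁ = Unit.η-iso₁
    ; η-iso₂ = Unit.η-iso₂
    ; η-natural = η-natural
    ; ε = Counit.ε
    ; ε⁻¹ = Counit.ε⁻¹
    ; ε-iso₁ = Counit.ε-iso₁
    ; ε-iso₂ = Counit.ε-iso₂
    ; ε-natural = ε-natural
    }

corollary5p2 : ∀ {o ℓ e : Level} (𝓔 : Category o ℓ e) (M : CETCS 𝓔) →
    Notions.HasFiniteProducts (ChoiceObjects 𝓔 M) ×
    Notions.HasWeakEqualisers (ChoiceObjects 𝓔 M) ×
    Equivalence 𝓔 (ExactCompletion.Ex (ChoiceObjects 𝓔 M))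
corollary5p2 𝓔 M = choice-finite-products , choice-weak-equalisers , equivalence
  where open InModel 𝓔 M
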